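{- Let $\Lambda$ and $\mathsf{C}$ be finite non-empty sets and let $m^\ast$ be a positive integer divisible by $|\Lambda|$ satisfying the following property $(\oplus)$: letting $\Omega=\{\bar\ell=\langle \ell_\alpha:\alpha\in\Lambda\rangle\in\mathcal{U}_{\Lambda,m^\ast}:\sum_{\alpha\in\Lambda}\ell_\alpha=m^\ast\}$, for every coloring $\mathbf{d}:\Omega\to\mathsf{C}$ there are $\ell^\ast>0$ and natural numbers $\langle\ell^\ast_\alpha:\alpha\in\Lambda\rangle$ such that, defining for each $\alpha\in\Lambda$ the function $\bar\ell^\alpha$ on $\Lambda$ by $\bar\ell^\alpha(\beta)=\ell^\ast_\beta$ for $\beta\ne\alpha$ and $\bar\ell^\alpha(\alpha)=\ell^\ast_\alpha+\ell^\ast$, we have $\bar\ell^\alpha\in\Omega$ for all $\alpha\in\Lambda$ and $\mathbf{d}$ is constant on $\{\bar\ell^\alpha:\alpha\in\Lambda\}$. Then $\mathrm{HJ}_{\mathsf{C}}(1,\Lambda)\le \mathtt{f}^{8,\ast}_{\Lambda}(m^\ast,\mathsf{C})$.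
   Context: For a natural number $n$ identify $n=\{0,\dots,n-1\}$. For finite sets $A,B$, $\mathcal{U}_{A,B}$ is the set of all functions $A\to B$; in particular $\mathcal{U}_{\Lambda,m^\ast}$ is the set of functions $\Lambda\to\{0,\dots,m^\ast-1\}$. For a finite non-empty linear order $M$, pairwise disjoint non-empty subsets $M_\ell$ ($\ell<m$) of $M$ and $\rho:M\setminus\bigcup_{\ell<m}M_\ell\to\Lambda$, $\mathcal{S}(\langle M_\ell:\ell<m\rangle,\rho)$ is the set of $\nu\in\mathcal{U}_{M,\Lambda}$ with $\nu\restriction(M\setminus\bigcup_\ell M_\ell)=\rho$ and $\nu\restriction M_\ell$ constant for each $\ell<m$; a line is such a set with $m=1$. $\mathrm{HJ}_{\mathsf{C}}(1,\Lambda)$ is the least $k$ such that for every linear order $M$ of size $k$ and every coloring $\mathbf{d}:\mathcal{U}_{M,\Lambda}\to\mathsf{C}$ there is a $\mathbf{d}$-monochromatic line in $\mathcal{U}_{M,\Lambda}$. For $m$ divisible by $|\Lambda|$, $\mathtt{f}^{8,\ast}_{\Lambda}(m,\mathsf{C})$ is the least $k$ divisible by $|\Lambda|$ such that for every linear order $M$ of size $k$ and every coloring $\mathbf{d}:\mathcal{U}_{M,\Lambda}\to\mathsf{C}$ there are pairwise disjoint non-empty subsets $M_\ell$ ($\ell<m$) of $M$ and $\rho:M\setminus\bigcup_{\ell<m}M_\ell\to\Lambda$ such that for all $\nu_1,\nu_2\in\mathcal{S}(\langle M_\ell:\ell<m\rangle,\rho)$, $\mathbf{d}(\nu_1)=\mathbf{d}(\nu_2)$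 whenever for every $\alpha\in\Lambda$, $|\{\ell<m:\nu_1\restriction M_\ell\equiv\alpha\}|=|\{\ell<m:\nu_2\restriction M_\ell\equiv\alpha\}|$. -}

module Defs where

open import Data.Nat using (ℕ; zero; suc; _+_; _≤_; _<_)
open import Data.Nat.Divisibility using (_∣_)
open import Data.Fin using (Fin; zero; suc; toℕ; _≟_)
open import Data.Bool using (Bool; true; false; if_then_else_; not; _∧_; _∨_)
open import Data.Product using (Σ; ∃; _×_; _,_; proj₁)
open import Relation.Nullary.Decidable using (⌊_⌋)
open import Relation.Binary.PropositionalEquality using (_≡_)

-- Λ is modelled as Fin a, C as Fin c, a linear order M of size k as Fin k
-- (only the size of M matters in the definitions below).

sumFin : ∀ {n} → (Fin n → ℕ) → ℕ
sumFin {zero}  f = 0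
sumFin {suc n} f = f zero + sumFin (λ i → f (suc i))

allB : ∀ {n} → (Fin n → Bool) → Bool
allB {zero}  f = true
allB {suc n} f = f zero ∧ allB (λ i → f (suc i))

countB : ∀ {n} → (Fin n → Bool) → ℕ
countB p = sumFin (λ i → if p i then 1 else 0)

Ω : (a m : ℕ) → Set
Ω a m = Σ (Fin a → Fin m) (λ ℓ → sumFin (λ α → toℕ (ℓ α)) ≡ m)

bump : ∀ {a} → (Fin a → ℕ) → ℕ → Fin a → Fin a → ℕ
bump ls l* α β = if ⌊ α ≟ β ⌋ then ls β + l* else ls β

Oplus : (a c m : ℕ) → Set
Oplus a c m =
  (d : Ω a m → Fin c) →
  Σ ℕ λ l* → 0 < l* ×
  Σ (Fin a → ℕ) λ ls →
  -- ws α is the element ℓ̄^α of Ω (witnessing ℓ̄^α ∈ Ω)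
  Σ (Fin a → Ω a m) λ ws →
    (∀ α β → toℕ (proj₁ (ws α) β) ≡ bump ls l* α β) ×
    (∀ α α′ → d (ws α) ≡ d (ws α′))

-- Ms ℓ is the characteristic function of M_ℓ ⊆ M
Disjoint : ∀ {m k} → (Fin m → Fin k → Bool) → Set
Disjoint Ms = ∀ ℓ ℓ′ i → Ms ℓ i ≡ true → Ms ℓ′ i ≡ true → ℓ ≡ ℓ′

NonEmpty : ∀ {m k} → (Fin m → Fin k → Bool) → Set
NonEmpty Ms = ∀ ℓ → ∃ λ i → Ms ℓ i ≡ true

-- ρ is given as a total function M → Λ; only its values on
-- M ∖ ⋃ M_ℓ are used.
InS : ∀ {m k a} → (Fin m → Fin k → Bool) → (Fin k → Fin a) →
      (Fin k → Fin a) → Set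
InS Ms ρ ν =
  (∀ i → (∀ ℓ → Ms ℓ i ≡ false) → ν i ≡ ρ i) ×
  (∀ ℓ i j → Ms ℓ i ≡ true → Ms ℓ j ≡ true → ν i ≡ ν j)

countCol : ∀ {m k a} → (Fin m → Fin k → Bool) → (Fin k → Fin a) →
           Fin a → ℕ
countCol Ms ν α = countB (λ ℓ → allB (λ i → not (Ms ℓ i) ∨ ⌊ ν i ≟ α ⌋))

-- HJ_C(1,Λ): k satisfies the Hales–Jewett property (lines have m = 1)

HJProp : (a c k : ℕ) → Set
HJProp a c k =
  (d : (Fin k → Fin a) → Fin c) →
  Σ (Fin 1 → Fin k → Bool) λ Ms → Σ (Fin k → Fin a) λ ρ →
    Disjoint Ms × NonEmpty Ms ×
    (∀ ν₁ ν₂ → InS Ms ρ ν₁ → InS Ms ρ ν₂ → d ν₁ ≡ d ν₂)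

F8Prop : (a c m k : ℕ) → Set
F8Prop a c m k =
  a ∣ k ×
  ((d : (Fin k → Fin a) → Fin c) →
   Σ (Fin m → Fin k → Bool) λ Ms → Σ (Fin k → Fin a) λ ρ →
     Disjoint Ms × NonEmpty Ms ×
     (∀ ν₁ ν₂ → InS Ms ρ ν₁ → InS Ms ρ ν₂ →
        (∀ α → countCol Ms ν₁ α ≡ countCol Ms ν₂ α) →
        d ν₁ ≡ d ν₂))

IsLeast : (ℕ → Set) → ℕ → Set
IsLeast P n = P n × (∀ k → P k → n ≤ k)

-- Let M_ℓ (ℓ < m*) and ρ be the subspace that the f^{8,*} property provides
-- for a colouring d of U_{M,Λ}: the colour of a point only depends on how
-- many blocks receive each letter. Colouring a profile ℓ̄ ∈ Ω by the colour of
-- a point whose blocks realise ℓ̄, property (⊕) yields ℓ*, ⟨ℓ*_α⟩ with all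
-- ℓ̄^α of one colour. Now lay out ℓ* "free" blocks and, for each β, ℓ*_β
-- blocks fixed to β. Letting the union of the free blocks move gives a line
-- whose point with moving letter α has profile ℓ̄^α, so the line is
-- monochromatic and M itself witnesses HJ_C(1,Λ).
module Submission where

open import Defs
open import Data.Nat using (ℕ; zero; suc; _+_; _≤_; _<_)
open import Data.Nat.Properties using (≤-refl; +-comm; +-assoc; +-identityʳ)
open import Data.Nat.Divisibility using (_∣_)
open import Data.Fin using (Fin; zero; suc; toℕ; _≟_; splitAt; _↑ˡ_; _↑ʳ_)
open import Data.Fin.Properties using (splitAt-↑ˡ; splitAt-↑ʳ; any?)
open import Data.Bool using (Bool; true; false; if_then_else_; not; _∧_; _∨_)
open import Data.Bool.Properties using (∨-zeroʳ) renaming (_≟_ to _≟ᴮ_)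
open import Data.Vec.Functional using (_∷_)
open import Data.Sum using (_⊎_; [_,_]′)
open import Data.Product using (Σ; ∃; _×_; _,_; proj₁; proj₂)
open import Function using (_∘_; id; const)
open import Relation.Nullary using (yes; no; contradiction)
open import Relation.Nullary.Decidable using (⌊_⌋; ⌊⌋-map′)
open import Relation.Binary.PropositionalEquality
open ≡-Reasoning

sumFin-cong : ∀ {n} {f g : Fin n → ℕ} → (∀ i → f i ≡ g i) → sumFin f ≡ sumFin g
sumFin-cong {zero}  _   = refl
sumFin-cong {suc n} f≗g = cong₂ _+_ (f≗g zero) (sumFin-cong (f≗g ∘ suc))

sumFin-zero : ∀ n → sumFin {n} (const 0) ≡ 0
sumFin-zero zero    = refl
sumFin-zero (suc n) = sumFin-zero n

sumFin-↑ : ∀ p q (f : Fin (p + q) → ℕ) →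
  sumFin f ≡ sumFin (λ i → f (i ↑ˡ q)) + sumFin (λ i → f (p ↑ʳ i))
sumFin-↑ zero    q f = refl
sumFin-↑ (suc p) q f = begin
  f zero + sumFin (f ∘ suc)
    ≡⟨ cong (f zero +_) (sumFin-↑ p q (f ∘ suc)) ⟩
  f zero + (sumFin (λ i → f (suc (i ↑ˡ q))) + _)
    ≡⟨ +-assoc (f zero) _ _ ⟨
  _ ∎

sumFin-point : ∀ {n} (x : Fin n → ℕ) β →
  sumFin (λ γ → if ⌊ γ ≟ β ⌋ then x γ else 0) ≡ x β
sumFin-point {suc n} x zero = begin
  x zero + sumFin {n} (const 0) ≡⟨ cong (x zero +_) (sumFin-zero n) ⟩
  x zero + 0                    ≡⟨ +-identityʳ (x zero) ⟩
  x zero                        ∎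
sumFin-point {suc n} x (suc β) = begin
  sumFin (λ γ → if ⌊ suc γ ≟ suc β ⌋ then x (suc γ) else 0)
    ≡⟨ sumFin-cong (λ γ → cong (if_then x (suc γ) else 0) (⌊⌋-map′ _ _ (γ ≟ β))) ⟩
  sumFin (λ γ → if ⌊ γ ≟ β ⌋ then x (suc γ) else 0)
    ≡⟨ sumFin-point (x ∘ suc) β ⟩
  x (suc β) ∎

countB-const : ∀ n b → countB {n} (const b) ≡ (if b then n else 0)
countB-const n       false = sumFin-zero n
countB-const zero    true  = refl
countB-const (suc n) true  = cong suc (countB-const n true)

0<countB⇒∃ : ∀ {n} (p : Fin n → Bool) → 0 < countB p → ∃ λ i → p i ≡ true
0<countB⇒∃ {suc n} p 0<count with p zero in p₀
... | true  = zero , p₀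
... | false = let i , pi = 0<countB⇒∃ (p ∘ suc) 0<count in suc i , pi

allB-true : ∀ {n} (p : Fin n → Bool) → (∀ i → p i ≡ true) → allB p ≡ true
allB-true {zero}  p _  = refl
allB-true {suc n} p p≡ rewrite p≡ zero = allB-true (p ∘ suc) (p≡ ∘ suc)

allB-false : ∀ {n} (p : Fin n → Bool) i → p i ≡ false → allB p ≡ false
allB-false p zero    pi rewrite pi = refl
allB-false p (suc i) pi rewrite allB-false (p ∘ suc) i pi with p zero
... | true  = refl
... | false = refl

allB-cong : ∀ {n} {p q : Fin n → Bool} → (∀ i → p i ≡ q i) → allB p ≡ allB q
allB-cong {zero}  _   = refl
allB-cong {suc n} p≗q = cong₂ _∧_ (p≗q zero) (allB-cong (p≗q ∘ suc))

allB-⇒const : ∀ {n} (S : Fin n → Bool) {i₀} b → S i₀ ≡ true →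
  allB (λ i → not (S i) ∨ b) ≡ b
allB-⇒const S true  _  = allB-true _ (λ i → ∨-zeroʳ (not (S i)))
allB-⇒const S {i₀} false S₀ = allB-false (λ i → not (S i) ∨ false) i₀ (cong (λ s → not s ∨ false) S₀)

-- The word 0^{L 0} 1^{L 1} ⋯
repeatIndices : ∀ {n} (L : Fin n → ℕ) → Fin (sumFin L) → Fin n
repeatIndices {suc n} L i =
  [ const zero , suc ∘ repeatIndices (L ∘ suc) ]′ (splitAt (L zero) i)

countB-repeatIndices : ∀ {n} (L : Fin n → ℕ) (P : Fin n → Bool) →
  countB (P ∘ repeatIndices L) ≡ sumFin (λ j → if P j then L j else 0)
countB-repeatIndices {zero}  L P = refl
countB-repeatIndices {suc n} L P = begin
  countB (P ∘ repeatIndices L)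
    ≡⟨ sumFin-↑ (L zero) (sumFin (L ∘ suc)) _ ⟩
  countB (λ i → P (word (splitAt (L zero) (i ↑ˡ sumFin (L ∘ suc)))))
    + countB (λ i → P (word (splitAt (L zero) (L zero ↑ʳ i))))
    ≡⟨ cong₂ _+_ (sumFin-cong (λ i → cong (indicator ∘ P ∘ word) (splitAt-↑ˡ (L zero) i _)))
                 (sumFin-cong (λ i → cong (indicator ∘ P ∘ word) (splitAt-↑ʳ (L zero) _ i))) ⟩
  countB {L zero} (const (P zero)) + countB (P ∘ suc ∘ repeatIndices (L ∘ suc))
    ≡⟨ cong₂ _+_ (countB-const (L zero) (P zero)) (countB-repeatIndices (L ∘ suc) (P ∘ suc)) ⟩
  sumFin (λ j → if P j then L j else 0) ∎
  where
  word : Fin (L zero) ⊎ Fin (sumFin (L ∘ suc)) → Fin (suc n)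
  word = [ const zero , suc ∘ repeatIndices (L ∘ suc) ]′
  indicator : Bool → ℕ
  indicator b = if b then 1 else 0

repeatIndices′ : ∀ {n m} (L : Fin n → ℕ) → sumFin L ≡ m → Fin m → Fin n
repeatIndices′ L refl = repeatIndices L

countB-repeatIndices′ : ∀ {n m} (L : Fin n → ℕ) (ΣL≡m : sumFin L ≡ m) (P : Fin n → Bool) →
  countB (P ∘ repeatIndices′ L ΣL≡m) ≡ sumFin (λ j → if P j then L j else 0)
countB-repeatIndices′ L refl = countB-repeatIndices L

multiplicity-repeatIndices′ : ∀ {n m} (L : Fin n → ℕ) (ΣL≡m : sumFin L ≡ m) j →
  countB (λ i → ⌊ repeatIndices′ L ΣL≡m i ≟ j ⌋) ≡ L j
multiplicity-repeatIndices′ L ΣL≡m j =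
  trans (countB-repeatIndices′ L ΣL≡m (λ i → ⌊ i ≟ j ⌋)) (sumFin-point L j)

-- With the letter moving on the blocks of type 0, (α ∷ id) sends block types
-- to letters; its letter profile is ℓ̄^α.
sumFin-bump : ∀ {n} (L : Fin (suc n) → ℕ) α β →
  sumFin (λ j → if ⌊ (α ∷ id) j ≟ β ⌋ then L j else 0) ≡ bump (L ∘ suc) (L zero) α β
sumFin-bump L α β = begin
  (if ⌊ α ≟ β ⌋ then L zero else 0) + sumFin (λ γ → if ⌊ γ ≟ β ⌋ then L (suc γ) else 0)
    ≡⟨ cong ((if ⌊ α ≟ β ⌋ then L zero else 0) +_) (sumFin-point (L ∘ suc) β) ⟩
  (if ⌊ α ≟ β ⌋ then L zero else 0) + L (suc β)
    ≡⟨ if-+ ⌊ α ≟ β ⌋ ⟩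
  bump (L ∘ suc) (L zero) α β ∎
  where
  if-+ : ∀ b → (if b then L zero else 0) + L (suc β) ≡ (if b then L (suc β) + L zero else L (suc β))
  if-+ true  = +-comm (L zero) (L (suc β))
  if-+ false = refl

module _ {m k : ℕ} (Ms : Fin m → Fin k → Bool) where

  Blockwise : ∀ {a} → (Fin k → Fin a) → (Fin m → Fin a) → Set
  Blockwise ν G = ∀ ℓ i → Ms ℓ i ≡ true → ν i ≡ G ℓ

  ProfileDetermined : ∀ {a c} → (Fin k → Fin a) → ((Fin k → Fin a) → Fin c) → Set
  ProfileDetermined ρ d = ∀ ν₁ ν₂ → InS Ms ρ ν₁ → InS Ms ρ ν₂ →
    (∀ α → countCol Ms ν₁ α ≡ countCol Ms ν₂ α) → d ν₁ ≡ d ν₂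

  Monochromatic : ∀ {a c} → (Fin k → Fin a) → ((Fin k → Fin a) → Fin c) → Set
  Monochromatic ρ d = ∀ ν₁ ν₂ → InS Ms ρ ν₁ → InS Ms ρ ν₂ → d ν₁ ≡ d ν₂

  InS-blockwise : ∀ {a} {ρ ν : Fin k → Fin a} G →
    (∀ i → (∀ ℓ → Ms ℓ i ≡ false) → ν i ≡ ρ i) → Blockwise ν G → InS Ms ρ ν
  InS-blockwise G outside blocks =
    outside , λ ℓ i j Msi Msj → trans (blocks ℓ i Msi) (sym (blocks ℓ j Msj))

  countCol-blockwise : ∀ {a} → NonEmpty Ms → (ν : Fin k → Fin a) (G : Fin m → Fin a) →
    Blockwise ν G → ∀ α → countCol Ms ν α ≡ countB (λ ℓ → ⌊ G ℓ ≟ α ⌋)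
  countCol-blockwise nonEmpty ν G blocks α =
    sumFin-cong λ ℓ → cong (if_then 1 else 0) (begin
      allB (λ i → not (Ms ℓ i) ∨ ⌊ ν i ≟ α ⌋)   ≡⟨ allB-cong (onBlock ℓ) ⟩
      allB (λ i → not (Ms ℓ i) ∨ ⌊ G ℓ ≟ α ⌋)   ≡⟨ allB-⇒const (Ms ℓ) _ (proj₂ (nonEmpty ℓ)) ⟩
      ⌊ G ℓ ≟ α ⌋                                ∎)
    where
    onBlock : ∀ ℓ i → not (Ms ℓ i) ∨ ⌊ ν i ≟ α ⌋ ≡ not (Ms ℓ i) ∨ ⌊ G ℓ ≟ α ⌋
    onBlock ℓ i with Ms ℓ i in Msi
    ... | true  = cong (λ x → ⌊ x ≟ α ⌋) (blocks ℓ i Msi)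
    ... | false = refl

  paint : {X : Set} → (Fin m → X) → (Fin k → X) → Fin k → X
  paint G r i with any? (λ ℓ → Ms ℓ i ≟ᴮ true)
  ... | yes (ℓ , _) = G ℓ
  ... | no _        = r i

  paint-inside : Disjoint Ms → ∀ {X} (G : Fin m → X) r {ℓ i} → Ms ℓ i ≡ true →
    paint G r i ≡ G ℓ
  paint-inside disjoint G r {ℓ} {i} Msi with any? (λ ℓ → Ms ℓ i ≟ᴮ true)
  ... | yes (ℓ′ , Ms′i) = cong G (disjoint ℓ′ ℓ i Ms′i Msi)
  ... | no  ¬any        = contradiction (ℓ , Msi) ¬any

  paint-outside : ∀ {X} (G : Fin m → X) r {i} → (∀ ℓ → Ms ℓ i ≡ false) →
    paint G r i ≡ r i
  paint-outside G r {i} outside with any? (λ ℓ → Ms ℓ i ≟ᴮ true)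
  ... | yes (ℓ , Msi) with () ← trans (sym (outside ℓ)) Msi
  ... | no _ = refl

  InS-paint : Disjoint Ms → ∀ {a} (G : Fin m → Fin a) ρ → InS Ms ρ (paint G ρ)
  InS-paint disjoint G ρ = InS-blockwise G (λ i → paint-outside G ρ)
    (λ ℓ i → paint-inside disjoint G ρ)

module HalesJewettLine
  {a c m k : ℕ}
  (Ms : Fin m → Fin k → Bool) (ρ : Fin k → Fin (suc a))
  (disjoint : Disjoint Ms) (nonEmpty : NonEmpty Ms)
  (d : (Fin k → Fin (suc a)) → Fin c) (profileDetermined : ProfileDetermined Ms ρ d)
  where

  realise : Ω (suc a) m → Fin k → Fin (suc a)
  realise w = paint Ms (repeatIndices′ (toℕ ∘ proj₁ w) (proj₂ w)) ρ

  countCol-realise : ∀ w β → countCol Ms (realise w) β ≡ toℕ (proj₁ w β)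
  countCol-realise w β = trans
    (countCol-blockwise Ms nonEmpty (realise w) _ (λ ℓ i → paint-inside Ms disjoint _ ρ) β)
    (multiplicity-repeatIndices′ (toℕ ∘ proj₁ w) (proj₂ w) β)

  module FromOplus
    (ℓ* : ℕ) (0<ℓ* : 0 < ℓ*) (ls : Fin (suc a) → ℕ) (ws : Fin (suc a) → Ω (suc a) m)
    (ws≡bump : ∀ α β → toℕ (proj₁ (ws α) β) ≡ bump ls ℓ* α β)
    (ws-mono : ∀ α α′ → d (realise (ws α)) ≡ d (realise (ws α′)))
    where

    L : Fin (suc (suc a)) → ℕ
    L = ℓ* ∷ ls

    sumFin-L : sumFin L ≡ m
    sumFin-L = begin
      ℓ* + (ls zero + sumFin (ls ∘ suc))   ≡⟨ +-assoc ℓ* (ls zero) _ ⟨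
      ℓ* + ls zero + sumFin (ls ∘ suc)     ≡⟨ cong (_+ sumFin (ls ∘ suc)) (+-comm ℓ* (ls zero)) ⟩
      sumFin (bump ls ℓ* zero)             ≡⟨ sumFin-cong (ws≡bump zero) ⟨
      sumFin (toℕ ∘ proj₁ (ws zero))       ≡⟨ proj₂ (ws zero) ⟩
      m                                    ∎

    -- Block ℓ is free if blockType ℓ = zero and fixed to γ if it is suc γ.
    blockType : Fin m → Fin (suc (suc a))
    blockType = repeatIndices′ L sumFin-L

    Ms′ : Fin 1 → Fin k → Bool
    Ms′ _ = paint Ms (λ ℓ → ⌊ blockType ℓ ≟ zero ⌋) (const false)

    ρ′ : Fin k → Fin (suc a)
    ρ′ = paint Ms ((zero ∷ id) ∘ blockType) ρ

    freeBlock : ∃ λ ℓ → ⌊ blockType ℓ ≟ zero ⌋ ≡ true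
    freeBlock = 0<countB⇒∃ _ (subst (0 <_) (sym (multiplicity-repeatIndices′ L sumFin-L zero)) 0<ℓ*)

    i₀ : Fin k
    i₀ = proj₁ (nonEmpty (proj₁ freeBlock))

    nonEmpty′ : NonEmpty Ms′
    nonEmpty′ zero = i₀ , trans (paint-inside Ms disjoint _ _ (proj₂ (nonEmpty _))) (proj₂ freeBlock)

    disjoint′ : Disjoint Ms′
    disjoint′ zero zero _ _ _ = refl

    module OnLine (ν : Fin k → Fin (suc a)) (ν∈line : InS Ms′ ρ′ ν) where

      outside : ∀ i → (∀ ℓ → Ms ℓ i ≡ false) → ν i ≡ ρ i
      outside i notInBlock = begin
        ν i    ≡⟨ proj₁ ν∈line i (λ { zero → paint-outside Ms _ _ notInBlock }) ⟩
        ρ′ i   ≡⟨ paint-outside Ms _ ρ notInBlock ⟩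
        ρ i    ∎

      blocks : Blockwise Ms ν ((ν i₀ ∷ id) ∘ blockType)
      blocks ℓ i Msi with blockType ℓ in type
      ... | zero  = proj₂ ν∈line zero i i₀ Ms′i (proj₂ (nonEmpty′ zero))
        where Ms′i = trans (paint-inside Ms disjoint _ _ Msi) (cong (λ t → ⌊ t ≟ zero ⌋) type)
      ... | suc γ = begin
        ν i    ≡⟨ proj₁ ν∈line i (λ { zero → trans (paint-inside Ms disjoint _ _ Msi)
                                                   (cong (λ t → ⌊ t ≟ zero ⌋) type) }) ⟩
        ρ′ i   ≡⟨ paint-inside Ms disjoint _ ρ Msi ⟩
        (zero ∷ id) (blockType ℓ) ≡⟨ cong (zero ∷ id) type ⟩
        γ      ∎

      countCol-line : ∀ β → countCol Ms ν β ≡ countCol Ms (realise (ws (ν i₀))) β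
      countCol-line β = begin
        countCol Ms ν β
          ≡⟨ countCol-blockwise Ms nonEmpty ν _ blocks β ⟩
        countB (λ ℓ → ⌊ (ν i₀ ∷ id) (blockType ℓ) ≟ β ⌋)
          ≡⟨ countB-repeatIndices′ L sumFin-L (λ j → ⌊ (ν i₀ ∷ id) j ≟ β ⌋) ⟩
        sumFin (λ j → if ⌊ (ν i₀ ∷ id) j ≟ β ⌋ then L j else 0)
          ≡⟨ sumFin-bump L (ν i₀) β ⟩
        bump ls ℓ* (ν i₀) β
          ≡⟨ ws≡bump (ν i₀) β ⟨
        toℕ (proj₁ (ws (ν i₀)) β)
          ≡⟨ countCol-realise (ws (ν i₀)) β ⟨
        countCol Ms (realise (ws (ν i₀))) β ∎

      colour : d ν ≡ d (realise (ws (ν i₀)))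
      colour = profileDetermined ν _ (InS-blockwise Ms _ outside blocks)
        (InS-paint Ms disjoint _ ρ) countCol-line

    monochromatic : Monochromatic Ms′ ρ′ d
    monochromatic ν₁ ν₂ ν₁∈line ν₂∈line = begin
      d ν₁                          ≡⟨ OnLine.colour ν₁ ν₁∈line ⟩
      d (realise (ws (ν₁ i₀)))      ≡⟨ ws-mono (ν₁ i₀) (ν₂ i₀) ⟩
      d (realise (ws (ν₂ i₀)))      ≡⟨ OnLine.colour ν₂ ν₂∈line ⟨
      d ν₂                          ∎

  line : Oplus (suc a) c m →
    Σ (Fin 1 → Fin k → Bool) λ Ms′ → Σ (Fin k → Fin (suc a)) λ ρ′ →
      Disjoint Ms′ × NonEmpty Ms′ × Monochromatic Ms′ ρ′ d
  line oplus with oplus (d ∘ realise)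
  ... | ℓ* , 0<ℓ* , ls , ws , ws≡bump , ws-mono =
    Ms′ , ρ′ , disjoint′ , nonEmpty′ , monochromatic
    where open FromOplus ℓ* 0<ℓ* ls ws ws≡bump ws-mono

lemma3p2 : (a c m : ℕ) → 0 < a → 0 < c → 0 < m → a ∣ m →
    Oplus a c m →
    (f : ℕ) → IsLeast (F8Prop a c m) f →
    ∃ λ h → h ≤ f × HJProp a c h
lemma3p2 (suc a) c m _ _ _ _ oplus f ((_ , f8) , _) = f , ≤-refl , λ d →
  let Ms , ρ , disjoint , nonEmpty , profileDetermined = f8 d
  in HalesJewettLine.line Ms ρ disjoint nonEmpty d profileDetermined oplus
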